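{- Two distinct seeds $\phi\neq\psi$ are neighbors if and only if one of them is the parent of the other. If $\phi=\mathrm{parent}(\psi)$, then $\mathrm{perms}(\phi)\cap\mathrm{perms}(\psi)=\mathrm{cycle}(\widetilde{\psi})$, this set contains $\phi^{(i)}$ for some $i$, and $\psi$ is the $i$-th son of $\phi$, i.e. $\psi=\mathrm{son}(\phi,i)$. If moreover $\mathrm{height}(\phi)=k<n-3$, then $\mathrm{height}(\psi)=\Delta(k,i)$. Furthermore, $\mathrm{son}(\phi,i)$ exists for every $i\in\{1,\dots,n-3\}$.
   Context: Fix $n\ge 4$. An $n$-permutation is a sequence listing each element of $\{1,\dots,n\}$ once; $\sigma(a_1,\dots,a_n)=(a_2,\dots,a_n,a_1)$, $\sigma^i$ is $\sigma$ applied $i$ times, and $\mathrm{cycle}(\pi)$ is the set of all cyclic shifts of $\pi$. On $\{1,\dots,n-1\}$ let $a\oplus1=a+1$ for $a<n-1$ and $(n-1)\oplus1=1$. A seed is a tuple $\psi=(a_1,\dots,a_{n-1})$ of distinct elements of $\{1,\dots,n\}$ with $a_1=n$ such that the unique element of $\{1,\dots,n\}$ not occurring in $\psi$ equals $a_2\oplus1$; it is denoted $\mathrm{mis}(\psi)$. $\mathrm{perms}(\psi)$ is the set of $n$-permutations obtained by inserting $\mathrm{mis}(\psi)$ at any position of $\psi$ and then applying any cyclic shift. Two distinct seeds are neighbors if their sets $\mathrm{perms}$ intersect. $\mathrm{height}(\psi)$ is the largest $k\in\{1,\dots,n-2\}$ with $a_j=a_{j+1}\oplus1$ for all $2\le j\le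 k$. $\widetilde{\psi}=(a_1,\mathrm{mis}(\psi),a_2,\dots,a_{n-1})$; for $1\le i\le n-1$, $\psi^{(i)}=(\mathrm{mis}(\psi),c_1,\dots,c_{n-1})$ where $(c_1,\dots,c_{n-1})$ is $(a_1,\dots,a_{n-1})$ rotated cyclically to the right by $i-1$ positions. For seeds $\psi,\beta$ we write $\mathrm{parent}(\beta)=\psi$ if $\psi,\beta$ are neighbors, $\mathrm{height}(\psi)>1$ and $\mathrm{mis}(\psi)=\mathrm{mis}(\beta)\oplus1$; if in addition $\sigma^i(\psi^{(i)})=\widetilde{\beta}$ we write $\mathrm{son}(\psi,i)=\beta$ and call $\beta$ the $i$-th son of $\psi$. $\Delta(k,i)=\min(k-1,n-2-i)$. -}

module Defs where

open import Data.Nat using (ℕ; zero; suc; _+_; _∸_; _<_; _≤_; _<ᵇ_; _≡ᵇ_; _⊔_; _⊓_)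
open import Data.Bool using (Bool; true; false; if_then_else_)
open import Data.List using (List; []; _∷_; _++_; [_]; reverse; take; drop; length; map; upTo)
open import Data.List.Relation.Binary.Permutation.Propositional using (_↭_)
open import Data.Product using (Σ; ∃; _×_; _,_)
open import Relation.Binary.PropositionalEquality using (_≡_; _≢_)

range : ℕ → List ℕ
range n = map suc (upTo n)

IsPerm : ℕ → List ℕ → Set
IsPerm n π = π ↭ range n

σ : List ℕ → List ℕ
σ [] = []
σ (x ∷ xs) = xs ++ [ x ]

σ^ : ℕ → List ℕ → List ℕ
σ^ zero l = l
σ^ (suc i) l = σ (σ^ i l)

InCycle : List ℕ → List ℕ → Set
InCycle π τ = ∃ λ i → τ ≡ σ^ i π

_⊕1 : {n : ℕ} → ℕ → ℕ
_⊕1 {n} a = if suc a <ᵇ n then suc a else 1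

-- mis(ψ) for ψ = (a1, a2, ...): by definition of a seed it equals a2 ⊕ 1
mis : ℕ → List ℕ → ℕ
mis n (a₁ ∷ a₂ ∷ _) = _⊕1 {n} a₂
mis n _ = 0

-- ψ = (a1,...,a_{n-1}) is a seed: a1 = n, the entries are distinct elements of
-- {1,...,n}, and the unique missing element of {1,...,n} is a2 ⊕ 1.
-- (Equivalently: ψ starts with n, a2, ... and (a2 ⊕ 1) ∷ ψ is an n-permutation.)
IsSeed : ℕ → List ℕ → Set
IsSeed n ψ = Σ ℕ λ a₂ → Σ (List ℕ) λ rest →
  (ψ ≡ n ∷ a₂ ∷ rest) × IsPerm n (_⊕1 {n} a₂ ∷ ψ)

-- insert x at position j (0-based) of l
insertAt : ℕ → ℕ → List ℕ → List ℕ
insertAt j x l = take j l ++ x ∷ drop j l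

InPerms : ℕ → List ℕ → List ℕ → Set
InPerms n ψ τ = Σ ℕ λ j → Σ ℕ λ i →
  (j ≤ length ψ) × (τ ≡ σ^ i (insertAt j (mis n ψ) ψ))

Neighbors : ℕ → List ℕ → List ℕ → Set
Neighbors n φ ψ = (φ ≢ ψ) × (∃ λ τ → InPerms n φ τ × InPerms n ψ τ)

chain : ℕ → List ℕ → ℕ
chain n (x ∷ y ∷ rest) = if x ≡ᵇ (_⊕1 {n} y) then suc (chain n (y ∷ rest)) else 0
chain n _ = 0

-- height(ψ): the largest k ∈ {1,...,n-2} with a_j = a_{j+1} ⊕ 1 for all 2 ≤ j ≤ k
height : ℕ → List ℕ → ℕ
height n [] = 1
height n (a₁ ∷ rest) = suc (chain n rest)

tilde : ℕ → List ℕ → List ℕ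
tilde n [] = []
tilde n (a₁ ∷ rest) = a₁ ∷ mis n (a₁ ∷ rest) ∷ rest

-- rotate cyclically to the right by one position: (a1,...,am) ↦ (am,a1,...,a_{m-1})
rotR1 : List ℕ → List ℕ
rotR1 l = reverse (σ (reverse l))

rotR : ℕ → List ℕ → List ℕ
rotR zero l = l
rotR (suc k) l = rotR1 (rotR k l)

sup : ℕ → List ℕ → ℕ → List ℕ
sup n ψ i = mis n ψ ∷ rotR (i ∸ 1) ψ

Parent : ℕ → List ℕ → List ℕ → Set
Parent n ψ β = Neighbors n ψ β × (1 < height n ψ) × (mis n ψ ≡ _⊕1 {n} (mis n β))

Son : ℕ → List ℕ → ℕ → List ℕ → Set
Son n ψ i β = Parent n ψ β × (σ^ i (sup n ψ i) ≡ tilde n β)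

Δ : ℕ → ℕ → ℕ → ℕ
Δ n k i = (k ∸ 1) ⊓ (n ∸ 2 ∸ i)

{-# OPTIONS --safe #-}
module Submission where

-- Every element of perms(ψ) is a rotation of the word n, ψ with mis(ψ) inserted somewhere
-- after n; since n occurs only once, two such rotations coincide exactly when these words
-- coincide. Comparing where the two missing elements were inserted leaves, up to swapping
-- the seeds, the single shape φ = (n, x⊕1, x, xs, ys), ψ = (n, x, xs, x⊕2, ys) with common
-- word ψ̃: every other placement forces φ = ψ or x = x⊕2, impossible since ⊕1 permutes
-- {1,…,n-1} cyclically with period n-1 ≥ 3. Here ψ is the (1+|ys|)-th son of φ, and its
-- height is the run of φ cut off at the inserted x⊕2, which cannot continue the run because
-- the height bound keeps the orbit of x from closing up.

open import Defs
open import Data.Bool using (true; false)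
open import Data.Empty using (⊥-elim)
open import Data.List using (List; []; _∷_; _++_; [_]; length; map; upTo; take; drop; reverse)
open import Data.List.Properties
  using (++-assoc; ++-identityʳ; length-++; length-map; length-upTo; length-drop; ∷-injective;
         reverse-++; reverse-involutive; take++drop≡id)
open import Data.List.Relation.Unary.All using (All; []; _∷_)
open import Data.List.Relation.Unary.All.Properties using (++⁻ˡ; ++⁻ʳ)
open import Data.List.Relation.Unary.AllPairs using (_∷_)
open import Data.List.Relation.Unary.Unique.Propositional using (Unique)
open import Data.List.Relation.Binary.Permutation.Propositional
  using (_↭_; ↭-sym; ↭-trans; ↭-refl; ↭-prep; ↭-swap; ↭⇒↭ₛ)
open import Data.List.Relation.Binary.Permutation.Propositional.Properties using (shift; ↭-length)
import Data.List.Relation.Binary.Permutation.Setoid.Properties as PermutationSetoid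
open import Data.List.Relation.Unary.Unique.Propositional.Properties as Unique using ()
open import Data.Nat using (ℕ; zero; suc; _+_; _*_; _∸_; _⊓_; _≤_; _<_; _<ᵇ_; _≡ᵇ_; z≤n; s≤s; s≤s⁻¹)
open import Data.Nat.GeneralisedArithmetic using (fold; fold-+)
open import Data.Nat.Properties
open import Data.Product using (Σ; ∃; _×_; _,_; proj₁; proj₂)
open import Data.Sum using (_⊎_; inj₁; inj₂)
open import Relation.Binary.PropositionalEquality
  using (_≡_; _≢_; refl; sym; trans; cong; subst; setoid; module ≡-Reasoning)
open import Relation.Nullary using (yes; no)

σ^-σ : ∀ k (l : List ℕ) → σ^ k (σ l) ≡ σ (σ^ k l)
σ^-σ zero    l = refl
σ^-σ (suc k) l = cong σ (σ^-σ k l)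

σ^-+ : ∀ a b (l : List ℕ) → σ^ a (σ^ b l) ≡ σ^ (a + b) l
σ^-+ zero    b l = refl
σ^-+ (suc a) b l = cong σ (σ^-+ a b l)

σ^-[] : ∀ a → σ^ a [] ≡ []
σ^-[] zero    = refl
σ^-[] (suc a) = cong σ (σ^-[] a)

σ^-length-++ : ∀ (xs ys : List ℕ) → σ^ (length xs) (xs ++ ys) ≡ ys ++ xs
σ^-length-++ []       ys = sym (++-identityʳ ys)
σ^-length-++ (x ∷ xs) ys = begin
  σ (σ^ (length xs) (x ∷ xs ++ ys))     ≡⟨ sym (σ^-σ (length xs) (x ∷ xs ++ ys)) ⟩
  σ^ (length xs) ((xs ++ ys) ++ [ x ])  ≡⟨ cong (σ^ (length xs)) (++-assoc xs ys [ x ]) ⟩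
  σ^ (length xs) (xs ++ (ys ++ [ x ]))  ≡⟨ σ^-length-++ xs (ys ++ [ x ]) ⟩
  (ys ++ [ x ]) ++ xs                   ≡⟨ ++-assoc ys [ x ] xs ⟩
  ys ++ x ∷ xs                          ∎
  where open ≡-Reasoning

σ^-length : ∀ (l : List ℕ) → σ^ (length l) l ≡ l
σ^-length l = trans (cong (σ^ (length l)) (sym (++-identityʳ l))) (σ^-length-++ l [])

σ^-*-length : ∀ c (l : List ℕ) → σ^ (c * length l) l ≡ l
σ^-*-length zero    l = refl
σ^-*-length (suc c) l = begin
  σ^ (length l + c * length l) l    ≡⟨ sym (σ^-+ (length l) (c * length l) l) ⟩
  σ^ (length l) (σ^ (c * length l) l) ≡⟨ cong (σ^ (length l)) (σ^-*-length c l) ⟩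
  σ^ (length l) l                   ≡⟨ σ^-length l ⟩
  l                                 ∎
  where open ≡-Reasoning

σ^-inverse : ∀ a (l : List ℕ) → ∃ λ d → σ^ d (σ^ a l) ≡ l
σ^-inverse a []      = 0 , σ^-[] a
σ^-inverse a (x ∷ l) = a * length l , (begin
  σ^ (a * length l) (σ^ a (x ∷ l)) ≡⟨ σ^-+ (a * length l) a (x ∷ l) ⟩
  σ^ (a * length l + a) (x ∷ l)    ≡⟨ cong (λ e → σ^ e (x ∷ l)) (trans (+-comm (a * length l) a)
                                                                   (sym (*-suc a (length l)))) ⟩
  σ^ (a * length (x ∷ l)) (x ∷ l)  ≡⟨ σ^-*-length a (x ∷ l) ⟩
  x ∷ l                            ∎)
  where open ≡-Reasoning

σ^-split : ∀ d (l : List ℕ) →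
  Σ (List ℕ) λ xs → Σ (List ℕ) λ ys → (l ≡ xs ++ ys) × (σ^ d l ≡ ys ++ xs)
σ^-split zero    l = [] , l , refl , sym (++-identityʳ l)
σ^-split (suc d) l with σ^-split d l
... | xs     , y ∷ ys , l≡ , σ^d≡ = xs ++ [ y ] , ys ,
      trans l≡ (sym (++-assoc xs [ y ] ys)) , trans (cong σ σ^d≡) (++-assoc ys xs [ y ])
... | []     , []     , l≡ , σ^d≡ = [] , [] , l≡ , cong σ σ^d≡
... | x ∷ xs , []     , l≡ , σ^d≡ = [ x ] , xs , trans l≡ (cong (x ∷_) (++-identityʳ xs)) , cong σ σ^d≡

σ^-fixes-unique-head : ∀ c (xs ys : List ℕ) d → All (c ≢_) xs → σ^ d (c ∷ xs) ≡ c ∷ ys → ys ≡ xs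
σ^-fixes-unique-head c xs ys d c∉xs σ^d≡ with σ^-split d (c ∷ xs)
... | []     , zs , l≡ , σ^≡ =
  proj₂ (∷-injective (trans (sym σ^d≡) (trans σ^≡ (trans (++-identityʳ zs) (sym l≡)))))
... | z ∷ zs , [] , l≡ , σ^≡ =
  proj₂ (∷-injective (trans (sym σ^d≡) (trans σ^≡ (trans (sym (++-identityʳ (z ∷ zs))) (sym l≡)))))
... | z ∷ zs , w ∷ ws , l≡ , σ^≡ with ∷-injective l≡
...   | refl , refl with ++⁻ʳ zs c∉xs
...     | c≢w ∷ _ = ⊥-elim (c≢w (sym (proj₁ (∷-injective (trans (sym σ^≡) σ^d≡)))))

σ^-cancel-unique-head : ∀ c (xs ys : List ℕ) k k′ → All (c ≢_) ys →
  σ^ k (c ∷ xs) ≡ σ^ k′ (c ∷ ys) → xs ≡ ys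
σ^-cancel-unique-head c xs ys k k′ c∉ys σ^k≡σ^k′ with σ^-inverse k (c ∷ xs)
... | d , σ^d∘σ^k≡id = σ^-fixes-unique-head c ys xs (d + k′) c∉ys (begin
  σ^ (d + k′) (c ∷ ys)     ≡⟨ sym (σ^-+ d k′ (c ∷ ys)) ⟩
  σ^ d (σ^ k′ (c ∷ ys))    ≡⟨ cong (σ^ d) (sym σ^k≡σ^k′) ⟩
  σ^ d (σ^ k (c ∷ xs))     ≡⟨ σ^d∘σ^k≡id ⟩
  c ∷ xs                   ∎)
  where open ≡-Reasoning

rotR1-∷ʳ : ∀ (l : List ℕ) z → rotR1 (l ++ [ z ]) ≡ z ∷ l
rotR1-∷ʳ l z = begin
  reverse (σ (reverse (l ++ [ z ]))) ≡⟨ cong (λ u → reverse (σ u)) (reverse-++ l [ z ]) ⟩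
  reverse (σ (z ∷ reverse l))        ≡⟨ reverse-++ (reverse l) [ z ] ⟩
  z ∷ reverse (reverse l)            ≡⟨ cong (z ∷_) (reverse-involutive l) ⟩
  z ∷ l                              ∎
  where open ≡-Reasoning

rotR-length-++ : ∀ (xs ys : List ℕ) → rotR (length ys) (xs ++ ys) ≡ ys ++ xs
rotR-length-++ xs []       = ++-identityʳ xs
rotR-length-++ xs (y ∷ ys) = begin
  rotR1 (rotR (length ys) (xs ++ y ∷ ys))         ≡⟨ cong (λ u → rotR1 (rotR (length ys) u)) (sym (++-assoc xs [ y ] ys)) ⟩
  rotR1 (rotR (length ys) ((xs ++ [ y ]) ++ ys))  ≡⟨ cong rotR1 (rotR-length-++ (xs ++ [ y ]) ys) ⟩
  rotR1 (ys ++ xs ++ [ y ])                       ≡⟨ cong rotR1 (sym (++-assoc ys xs [ y ])) ⟩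
  rotR1 ((ys ++ xs) ++ [ y ])                     ≡⟨ rotR1-∷ʳ (ys ++ xs) y ⟩
  y ∷ ys ++ xs                                    ∎
  where open ≡-Reasoning

insertAt-length-++ : ∀ (xs ys : List ℕ) m → insertAt (length xs) m (xs ++ ys) ≡ xs ++ m ∷ ys
insertAt-length-++ []       ys m = refl
insertAt-length-++ (x ∷ xs) ys m = cong (x ∷_) (insertAt-length-++ xs ys m)

insertAt-split : ∀ j (l : List ℕ) m → j ≤ length l →
  Σ (List ℕ) λ xs → Σ (List ℕ) λ ys → (l ≡ xs ++ ys) × (insertAt j m l ≡ xs ++ m ∷ ys)
insertAt-split zero    l       m _       = [] , l , refl , refl
insertAt-split (suc j) (x ∷ l) m (s≤s j≤) with insertAt-split j l m j≤
... | xs , ys , l≡ , ins≡ = x ∷ xs , ys , cong (x ∷_) l≡ , cong (x ∷_) ins≡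

split-suffix : ∀ (l : List ℕ) k → k ≤ length l →
  Σ (List ℕ) λ xs → Σ (List ℕ) λ ys → (l ≡ xs ++ ys) × (length ys ≡ k)
split-suffix l k k≤ = take (length l ∸ k) l , drop (length l ∸ k) l ,
  sym (take++drop≡id (length l ∸ k) l) ,
  trans (length-drop (length l ∸ k) l) (m∸[m∸n]≡n k≤)

++-∷-cancel : ∀ m (xs ys xs′ ys′ : List ℕ) → All (m ≢_) xs → All (m ≢_) xs′ →
  xs ++ m ∷ ys ≡ xs′ ++ m ∷ ys′ → xs ++ ys ≡ xs′ ++ ys′
++-∷-cancel m []       ys []         ys′ _          _            eq = proj₂ (∷-injective eq)
++-∷-cancel m []       ys (x′ ∷ xs′) ys′ _          (m≢x′ ∷ _)   eq = ⊥-elim (m≢x′ (proj₁ (∷-injective eq)))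
++-∷-cancel m (x ∷ xs) ys []         ys′ (m≢x ∷ _)  _            eq = ⊥-elim (m≢x (sym (proj₁ (∷-injective eq))))
++-∷-cancel m (x ∷ xs) ys (x′ ∷ xs′) ys′ (_ ∷ m∉xs) (_ ∷ m∉xs′) eq with ∷-injective eq
... | refl , eq′ = cong (x ∷_) (++-∷-cancel m xs ys xs′ ys′ m∉xs m∉xs′ eq′)

Unique-resp-↭ : {xs ys : List ℕ} → xs ↭ ys → Unique xs → Unique ys
Unique-resp-↭ p = PermutationSetoid.Unique-resp-↭ (setoid ℕ) (↭⇒↭ₛ p)

IsPerm-length : ∀ {n} {l : List ℕ} → IsPerm n l → length l ≡ n
IsPerm-length {n} p = trans (↭-length p) (trans (length-map suc (upTo n)) (length-upTo n))

IsPerm-Unique : ∀ {n} {l : List ℕ} → IsPerm n l → Unique l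
IsPerm-Unique p = Unique-resp-↭ (↭-sym p) (Unique.map⁺ suc-injective (Unique.upTo⁺ _))

∷-++-∷-↭ : ∀ (m c : ℕ) xs ys → (c ∷ xs ++ m ∷ ys) ↭ (m ∷ c ∷ xs ++ ys)
∷-++-∷-↭ m c xs ys = ↭-trans (↭-prep c (shift m xs ys)) (↭-swap c m ↭-refl)

module CyclicSuccessor (N : ℕ) where

  infixl 10 _⁺
  _⁺ : ℕ → ℕ
  a ⁺ = _⊕1 {suc N} a

  infixl 9 _⁺^_
  _⁺^_ : ℕ → ℕ → ℕ
  x ⁺^ t = fold x _⁺ t

  ⁺-< : ∀ {a} → a < N → a ⁺ ≡ suc a
  ⁺-< {a} a<N with a <ᵇ N | <⇒<ᵇ a<N
  ... | true  | _ = refl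
  ... | false | ()

  N⁺ : N ⁺ ≡ 1
  N⁺ with N <ᵇ N | <ᵇ⇒< N N
  ... | false | _      = refl
  ... | true  | N<N = ⊥-elim (n≮n N (N<N _))

  ⁺-range : ∀ a → 1 ≤ N → 1 ≤ a ⁺ × a ⁺ ≤ N
  ⁺-range a 1≤N with a <ᵇ N | <ᵇ⇒< a N
  ... | true  | a<N = s≤s z≤n , a<N _
  ... | false | _   = s≤s z≤n , 1≤N

  ⁺-⁺^ : ∀ x t → x ⁺ ⁺^ t ≡ x ⁺^ suc t
  ⁺-⁺^ x zero    = refl
  ⁺-⁺^ x (suc t) = cong _⁺ (⁺-⁺^ x t)

  ⁺^-formula : ∀ y t → 1 ≤ y → y ≤ N → t ≤ N →
    ((y + t ≤ N) × (y ⁺^ t ≡ y + t)) ⊎ ((N < y + t) × (y ⁺^ t + N ≡ y + t))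
  ⁺^-formula y zero    _ y≤N _ = inj₁ (subst (_≤ N) (sym (+-identityʳ y)) y≤N , sym (+-identityʳ y))
  ⁺^-formula y (suc t) 1≤y y≤N t<N with ⁺^-formula y t 1≤y y≤N (<⇒≤ t<N)
  ⁺^-formula y (suc t) 1≤y y≤N t<N | inj₂ (N<y+t , y⁺^t+N≡) =
    inj₂ (<-trans N<y+t (subst (y + t <_) (sym (+-suc y t)) (n<1+n (y + t))) ,
          trans (cong (_+ N) (⁺-< y⁺^t<N)) (trans (cong suc y⁺^t+N≡) (sym (+-suc y t))))
    where
    y⁺^t<N : y ⁺^ t < N
    y⁺^t<N = +-cancelʳ-< N (y ⁺^ t) N (subst (_< N + N) (sym y⁺^t+N≡) (+-mono-≤-< y≤N t<N))
  ... | inj₁ (y+t≤N , y⁺^t≡) with y + t <? N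
  ...   | yes y+t<N = inj₁ (subst (_≤ N) (sym (+-suc y t)) y+t<N ,
            trans (cong _⁺ y⁺^t≡) (trans (⁺-< y+t<N) (sym (+-suc y t))))
  ...   | no  y+t≮N = inj₂ (subst (N <_) (sym (+-suc y t)) (s≤s (≤-reflexive (sym y+t≡N))) ,
            trans (cong (λ z → z ⁺ + N) (trans y⁺^t≡ y+t≡N))
                  (trans (cong (_+ N) N⁺) (trans (cong suc (sym y+t≡N)) (sym (+-suc y t)))))
    where
    y+t≡N : y + t ≡ N
    y+t≡N = ≤-antisym y+t≤N (≮⇒≥ y+t≮N)

  ⁺^-no-fixed-point-on-range : ∀ y t → 1 ≤ y → y ≤ N → 0 < t → t < N → y ⁺^ t ≢ y
  ⁺^-no-fixed-point-on-range y t 1≤y y≤N 0<t t<N y⁺^t≡y with ⁺^-formula y t 1≤y y≤N (<⇒≤ t<N)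
  ... | inj₁ (_ , y⁺^t≡) = <⇒≢ 0<t (sym (+-cancelˡ-≡ y t 0
          (trans (sym y⁺^t≡) (trans y⁺^t≡y (sym (+-identityʳ y))))))
  ... | inj₂ (_ , y⁺^t+N≡) = <⇒≢ t<N (sym (+-cancelˡ-≡ y N t
          (trans (cong (_+ N) (sym y⁺^t≡y)) y⁺^t+N≡)))

  ⁺^-no-fixed-point : ∀ x t → 0 < t → t < N → x ⁺^ t ≢ x
  ⁺^-no-fixed-point x t 0<t t<N x⁺^t≡x =
    ⁺^-no-fixed-point-on-range (x ⁺) t (proj₁ x⁺-range) (proj₂ x⁺-range) 0<t t<N
      (trans (⁺-⁺^ x t) (cong _⁺ x⁺^t≡x))
    where
    x⁺-range : 1 ≤ x ⁺ × x ⁺ ≤ N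
    x⁺-range = ⁺-range x (<-≤-trans 0<t (<⇒≤ t<N))

  chain-⁺∷ : ∀ x (L : List ℕ) → chain (suc N) (x ⁺ ∷ x ∷ L) ≡ suc (chain (suc N) (x ∷ L))
  chain-⁺∷ x L with x ⁺ ≡ᵇ x ⁺ | ≡⇒≡ᵇ (x ⁺) (x ⁺) refl
  ... | true  | _ = refl
  ... | false | ()

  chain-positive⇒⁺ : ∀ a b l → 0 < chain (suc N) (a ∷ b ∷ l) → a ≡ b ⁺
  chain-positive⇒⁺ a b l 0<chain with a ≡ᵇ b ⁺ | ≡ᵇ⇒≡ a (b ⁺)
  chain-positive⇒⁺ a b l ()       | false | _
  ... | true | a≡b⁺ = a≡b⁺ _

  chain-insert : ∀ x (L : List ℕ) m ys →
    (length L ≤ chain (suc N) (x ∷ L ++ ys) → x ≢ m ⁺^ suc (length L)) →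
    chain (suc N) (x ∷ L ++ m ∷ ys) ≡ chain (suc N) (x ∷ L ++ ys) ⊓ length L
  chain-insert x []      m ys x≢ with x ≡ᵇ m ⁺ | ≡ᵇ⇒≡ x (m ⁺)
  ... | true  | x≡m⁺ = ⊥-elim (x≢ z≤n (x≡m⁺ _))
  ... | false | _    = sym (⊓-zeroʳ (chain (suc N) (x ∷ ys)))
  chain-insert x (y ∷ L) m ys x≢ with x ≡ᵇ y ⁺ | ≡ᵇ⇒≡ x (y ⁺)
  ... | false | _    = refl
  ... | true  | x≡y⁺ = cong suc (chain-insert y L m ys
        (λ |L|≤ y≡ → x≢ (s≤s |L|≤) (trans (x≡y⁺ _) (cong _⁺ y≡))))

module Seeds (N : ℕ) (3≤N : 3 ≤ N) where

  open CyclicSuccessor N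

  private
    n : ℕ
    n = suc N

  Neighbors-sym : ∀ {φ ψ} → Neighbors n φ ψ → Neighbors n ψ φ
  Neighbors-sym (φ≢ψ , τ , τ∈φ , τ∈ψ) = (λ ψ≡φ → φ≢ψ (sym ψ≡φ)) , τ , τ∈ψ , τ∈φ

  x≢x⁺ : ∀ x → x ≢ x ⁺
  x≢x⁺ x x≡x⁺ = ⁺^-no-fixed-point x 1 (s≤s z≤n) (≤-trans (s≤s (s≤s z≤n)) 3≤N) (sym x≡x⁺)

  x≢x⁺⁺ : ∀ x → x ≢ x ⁺ ⁺
  x≢x⁺⁺ x x≡x⁺⁺ = ⁺^-no-fixed-point x 2 (s≤s z≤n) 3≤N (sym x≡x⁺⁺)

  -- The parent misses x ⁺ ⁺ and its son misses x ⁺; both are obtained from the common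
  -- permutation  n, x ⁺, x, xs, x ⁺ ⁺, ys  by deleting the missing element.
  parentSeed sonSeed : ℕ → List ℕ → List ℕ → List ℕ
  parentSeed x xs ys = n ∷ x ⁺ ∷ x ∷ xs ++ ys
  sonSeed    x xs ys = n ∷ x ∷ xs ++ x ⁺ ⁺ ∷ ys

  ParentSon : List ℕ → List ℕ → Set
  ParentSon φ ψ = Σ ℕ λ x → Σ (List ℕ) λ xs → Σ (List ℕ) λ ys →
    (φ ≡ parentSeed x xs ys) × (ψ ≡ sonSeed x xs ys)

  ParentSon-cycle⊆perms : ∀ {φ ψ τ} → ParentSon φ ψ → InCycle (tilde n ψ) τ →
    InPerms n φ τ × InPerms n ψ τ
  ParentSon-cycle⊆perms (x , xs , ys , refl , refl) (k , τ≡) =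
    (length prefix , k , length-prefix≤ , trans τ≡ (cong (σ^ k) (sym (insertAt-length-++ prefix ys (x ⁺ ⁺))))) ,
    (1 , k , s≤s z≤n , τ≡)
    where
    prefix : List ℕ
    prefix = n ∷ x ⁺ ∷ x ∷ xs
    length-prefix≤ : length prefix ≤ length (prefix ++ ys)
    length-prefix≤ = ≤-trans (m≤m+n (length prefix) (length ys)) (≤-reflexive (sym (length-++ prefix)))

  parentSeed-sonSeed-neighbors : ∀ x xs ys → Neighbors n (parentSeed x xs ys) (sonSeed x xs ys)
  parentSeed-sonSeed-neighbors x xs ys =
    (λ φ≡ψ → x≢x⁺ x (sym (proj₁ (∷-injective (proj₂ (∷-injective φ≡ψ)))))) ,
    _ , ParentSon-cycle⊆perms (x , xs , ys , refl , refl) (0 , refl)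

  parentSeed-sonSeed-son : ∀ x xs ys → Son n (parentSeed x xs ys) (suc (length ys)) (sonSeed x xs ys)
  parentSeed-sonSeed-son x xs ys =
    (parentSeed-sonSeed-neighbors x xs ys , 1<height , refl) , σ^-sup≡tilde
    where
    1<height : 1 < height n (parentSeed x xs ys)
    1<height = subst (1 <_) (cong suc (sym (chain-⁺∷ x (xs ++ ys)))) (s≤s (s≤s z≤n))
    σ^-sup≡tilde : σ^ (suc (length ys)) (sup n (parentSeed x xs ys) (suc (length ys))) ≡ tilde n (sonSeed x xs ys)
    σ^-sup≡tilde = begin
      σ^ (suc (length ys)) (x ⁺ ⁺ ∷ rotR (length ys) (n ∷ x ⁺ ∷ x ∷ xs ++ ys))
        ≡⟨ cong (λ l → σ^ (suc (length ys)) (x ⁺ ⁺ ∷ l)) (rotR-length-++ (n ∷ x ⁺ ∷ x ∷ xs) ys) ⟩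
      σ^ (length (x ⁺ ⁺ ∷ ys)) ((x ⁺ ⁺ ∷ ys) ++ n ∷ x ⁺ ∷ x ∷ xs)
        ≡⟨ σ^-length-++ (x ⁺ ⁺ ∷ ys) (n ∷ x ⁺ ∷ x ∷ xs) ⟩
      tilde n (sonSeed x xs ys) ∎
      where open ≡-Reasoning

  parentSeed-length : ∀ x xs ys → IsPerm n (x ⁺ ⁺ ∷ parentSeed x xs ys) → N ≡ 3 + length xs + length ys
  parentSeed-length x xs ys p =
    trans (sym (suc-injective (IsPerm-length p))) (cong (λ k → 3 + k) (length-++ xs))

  sonSeed-height : ∀ x xs ys → N ≡ 3 + length xs + length ys →
    height n (parentSeed x xs ys) < n ∸ 3 →
    height n (sonSeed x xs ys) ≡ Δ n (height n (parentSeed x xs ys)) (suc (length ys))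
  sonSeed-height x xs ys N≡ height< rewrite chain-⁺∷ x (xs ++ ys) = begin
    suc (chain n (x ∷ xs ++ x ⁺ ⁺ ∷ ys)) ≡⟨ cong suc (chain-insert x xs (x ⁺ ⁺) ys x≢) ⟩
    suc c ⊓ suc (length xs)              ≡⟨ cong (suc c ⊓_) (sym N∸1∸suc|ys|≡) ⟩
    suc c ⊓ (N ∸ 1 ∸ suc (length ys))    ∎
    where
    open ≡-Reasoning
    N∸1∸suc|ys|≡ : N ∸ 1 ∸ suc (length ys) ≡ suc (length xs)
    N∸1∸suc|ys|≡ = trans (cong (λ k → k ∸ 1 ∸ suc (length ys)) N≡) (m+n∸n≡m (suc (length xs)) (length ys))
    c : ℕ
    c = chain n (x ∷ xs ++ ys)
    x≢ : length xs ≤ c → x ≢ x ⁺ ⁺ ⁺^ suc (length xs)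
    x≢ |xs|≤c x≡ = ⁺^-no-fixed-point x (suc (length xs) + 2) (s≤s z≤n)
      (≤-trans (+-monoˡ-≤ 2 (s≤s (s≤s |xs|≤c)))
               (m≤o∸n⇒m+n≤o (suc (suc c)) (≤-trans (n≤1+n 2) 3≤N) (<⇒≤ height<)))
      (sym (trans x≡ (sym (fold-+ x _⁺ (suc (length xs)) {2}))))

  InPerms-normal-form : ∀ a r τ → InPerms n (n ∷ a ∷ r) τ →
    Σ (List ℕ) λ xs → Σ (List ℕ) λ ys → Σ ℕ λ k →
      (a ∷ r ≡ xs ++ ys) × (τ ≡ σ^ k (n ∷ xs ++ a ⁺ ∷ ys))
  InPerms-normal-form a r τ (zero , i , _ , τ≡) = a ∷ r , [] , i + length (n ∷ a ∷ r) ,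
    sym (++-identityʳ (a ∷ r)) ,
    trans τ≡ (trans (cong (σ^ i) (sym (σ^-length-++ (n ∷ a ∷ r) [ a ⁺ ])))
                    (σ^-+ i (length (n ∷ a ∷ r)) (n ∷ a ∷ r ++ [ a ⁺ ])))
  InPerms-normal-form a r τ (suc j , i , s≤s j≤ , τ≡) with insertAt-split j (a ∷ r) (a ⁺) j≤
  ... | xs , ys , a∷r≡ , ins≡ = xs , ys , i , a∷r≡ , trans τ≡ (cong (λ l → σ^ i (n ∷ l)) ins≡)

  insertion-Unique : ∀ a r xs ys → IsPerm n (a ⁺ ∷ n ∷ a ∷ r) → a ∷ r ≡ xs ++ ys →
    Unique (n ∷ xs ++ a ⁺ ∷ ys)
  insertion-Unique a r xs ys p a∷r≡ = Unique-resp-↭ (↭-sym (∷-++-∷-↭ (a ⁺) n xs ys))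
    (subst (λ l → Unique (a ⁺ ∷ n ∷ l)) a∷r≡ (IsPerm-Unique p))

  front-insertion-parent : ∀ a r b r′ y X ys′ →
    b ∷ r′ ≡ y ∷ X ++ ys′ → a ⁺ ∷ a ∷ r ≡ y ∷ X ++ b ⁺ ∷ ys′ → ParentSon (n ∷ b ∷ r′) (n ∷ a ∷ r)
  front-insertion-parent a r b r′ y X ys′ b∷r′≡ W≡ with ∷-injective W≡ | ∷-injective b∷r′≡
  ... | refl , a∷r≡ | refl , refl with X
  ...   | []     = ⊥-elim (x≢x⁺⁺ a (proj₁ (∷-injective a∷r≡)))
  ...   | z ∷ X′ with ∷-injective a∷r≡
  ...     | refl , refl = a , X′ , ys′ , refl , refl

  insertion-cases : ∀ a r b r′ xs ys xs′ ys′ →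
    Unique (a ⁺ ∷ n ∷ a ∷ r) → Unique (b ⁺ ∷ n ∷ b ∷ r′) → _≢_ {A = List ℕ} (n ∷ a ∷ r) (n ∷ b ∷ r′) →
    a ∷ r ≡ xs ++ ys → b ∷ r′ ≡ xs′ ++ ys′ → xs ++ a ⁺ ∷ ys ≡ xs′ ++ b ⁺ ∷ ys′ →
    (ParentSon (n ∷ a ∷ r) (n ∷ b ∷ r′) × (n ∷ xs ++ a ⁺ ∷ ys ≡ tilde n (n ∷ b ∷ r′)))
    ⊎ (ParentSon (n ∷ b ∷ r′) (n ∷ a ∷ r) × (n ∷ xs ++ a ⁺ ∷ ys ≡ tilde n (n ∷ a ∷ r)))
  insertion-cases a r b r′ [] ys [] ys′ _ _ φ≢ψ refl refl W≡ =
    ⊥-elim (φ≢ψ (cong (n ∷_) (proj₂ (∷-injective W≡))))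
  insertion-cases a r b r′ [] ys (y ∷ X) ys′ _ _ _ refl b∷r′≡ W≡ =
    inj₂ (front-insertion-parent a r b r′ y X ys′ b∷r′≡ W≡ , refl)
  insertion-cases a r b r′ (x ∷ X) ys [] ys′ _ _ _ a∷r≡ refl W≡ =
    inj₁ (front-insertion-parent b r′ a r x X ys a∷r≡ (sym W≡) , cong (n ∷_) W≡)
  -- Both words then start with a = b, so the seeds miss the same element; deleting it gives φ = ψ.
  insertion-cases a r b r′ (x ∷ X) ys (x′ ∷ X′) ys′
    ((_ ∷ _ ∷ a⁺∉) ∷ _) ((_ ∷ _ ∷ b⁺∉) ∷ _) φ≢ψ a∷r≡ b∷r′≡ W≡
    with ∷-injective a∷r≡ | ∷-injective b∷r′≡ | ∷-injective W≡
  ... | refl , refl | refl , refl | refl , W≡′ =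
    ⊥-elim (φ≢ψ (cong (λ l → n ∷ a ∷ l)
      (++-∷-cancel (a ⁺) X ys X′ ys′ (++⁻ˡ X a⁺∉) (++⁻ˡ X′ b⁺∉) W≡′)))

  common-perm-ParentSon : ∀ {φ ψ τ} → IsSeed n φ → IsSeed n ψ → φ ≢ ψ →
    InPerms n φ τ → InPerms n ψ τ →
    (ParentSon φ ψ × InCycle (tilde n ψ) τ) ⊎ (ParentSon ψ φ × InCycle (tilde n φ) τ)
  common-perm-ParentSon {τ = τ} (a , r , refl , p) (b , r′ , refl , p′) φ≢ψ τ∈φ τ∈ψ
    with InPerms-normal-form a r τ τ∈φ | InPerms-normal-form b r′ τ τ∈ψ
  ... | xs , ys , k , a∷r≡ , τ≡ | xs′ , ys′ , k′ , b∷r′≡ , τ≡′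
    with insertion-Unique b r′ xs′ ys′ p′ b∷r′≡
  ... | n∉W′ ∷ _
    with insertion-cases a r b r′ xs ys xs′ ys′ (IsPerm-Unique p) (IsPerm-Unique p′) φ≢ψ a∷r≡ b∷r′≡
           (σ^-cancel-unique-head n _ _ k k′ n∉W′ (trans (sym τ≡) τ≡′))
  ... | inj₁ (φψ , W≡) = inj₁ (φψ , k , trans τ≡ (cong (σ^ k) W≡))
  ... | inj₂ (ψφ , W≡) = inj₂ (ψφ , k , trans τ≡ (cong (σ^ k) W≡))

  sonSeed-IsSeed : ∀ x xs ys → IsPerm n (x ⁺ ⁺ ∷ parentSeed x xs ys) → IsSeed n (sonSeed x xs ys)
  sonSeed-IsSeed x xs ys p = x , xs ++ x ⁺ ⁺ ∷ ys , refl ,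
    ↭-trans (↭-swap (x ⁺) n ↭-refl) (↭-trans (∷-++-∷-↭ (x ⁺ ⁺) n (x ⁺ ∷ x ∷ xs) ys) p)

  ParentSon⇒Parent : ∀ {φ ψ} → ParentSon φ ψ → Parent n φ ψ
  ParentSon⇒Parent (x , xs , ys , refl , refl) = proj₁ (parentSeed-sonSeed-son x xs ys)

  ParentSon⇒mis≢ : ∀ {φ ψ} → ParentSon ψ φ → mis n φ ≢ mis n ψ ⁺
  ParentSon⇒mis≢ (x , xs , ys , refl , refl) = x≢x⁺⁺ (x ⁺)

  Parent⇒ParentSon : ∀ {φ ψ} → IsSeed n φ → IsSeed n ψ → Parent n φ ψ → ParentSon φ ψ
  Parent⇒ParentSon sφ sψ ((φ≢ψ , _ , τ∈φ , τ∈ψ) , _ , mis≡)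
    with common-perm-ParentSon sφ sψ φ≢ψ τ∈φ τ∈ψ
  ... | inj₁ (φψ , _) = φψ
  ... | inj₂ (ψφ , _) = ⊥-elim (ParentSon⇒mis≢ ψφ mis≡)

  ParentSon-son : ∀ {φ ψ} → IsSeed n φ → ParentSon φ ψ →
    ∃ λ i → (1 ≤ i) × (i < n) × InCycle (tilde n ψ) (sup n φ i) × Son n φ i ψ
          × (height n φ < n ∸ 3 → height n ψ ≡ Δ n (height n φ) i)
  ParentSon-son (_ , _ , refl , p) (x , xs , ys , refl , refl) =
    suc (length ys) , s≤s z≤n , s≤s (subst (suc (length ys) ≤_) (sym N≡) (s≤s (m≤n+m (length ys) (2 + length xs)))) ,
    sup∈cycle , son , sonSeed-height x xs ys N≡
    where
    N≡ : N ≡ 3 + length xs + length ys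
    N≡ = parentSeed-length x xs ys p
    son : Son n (parentSeed x xs ys) (suc (length ys)) (sonSeed x xs ys)
    son = parentSeed-sonSeed-son x xs ys
    sup∈cycle : InCycle (tilde n (sonSeed x xs ys)) (sup n (parentSeed x xs ys) (suc (length ys)))
    sup∈cycle with σ^-inverse (suc (length ys)) (sup n (parentSeed x xs ys) (suc (length ys)))
    ... | d , σ^d∘σ^i≡id = d , trans (sym σ^d∘σ^i≡id) (cong (σ^ d) (proj₂ son))

  neighbors⇔parent : (φ ψ : List ℕ) → IsSeed n φ → IsSeed n ψ → φ ≢ ψ →
    (Neighbors n φ ψ → Parent n φ ψ ⊎ Parent n ψ φ) × (Parent n φ ψ ⊎ Parent n ψ φ → Neighbors n φ ψ)
  neighbors⇔parent φ ψ sφ sψ φ≢ψ = to , from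
    where
    to : Neighbors n φ ψ → Parent n φ ψ ⊎ Parent n ψ φ
    to (_ , _ , τ∈φ , τ∈ψ) with common-perm-ParentSon sφ sψ φ≢ψ τ∈φ τ∈ψ
    ... | inj₁ (φψ , _) = inj₁ (ParentSon⇒Parent φψ)
    ... | inj₂ (ψφ , _) = inj₂ (ParentSon⇒Parent ψφ)
    from : Parent n φ ψ ⊎ Parent n ψ φ → Neighbors n φ ψ
    from (inj₁ par) = proj₁ par
    from (inj₂ par) = Neighbors-sym (proj₁ par)

  Parent-common-perms : (φ ψ : List ℕ) → IsSeed n φ → IsSeed n ψ → Parent n φ ψ → (τ : List ℕ) →
    (InPerms n φ τ × InPerms n ψ τ → InCycle (tilde n ψ) τ)
    × (InCycle (tilde n ψ) τ → InPerms n φ τ × InPerms n ψ τ)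
  Parent-common-perms φ ψ sφ sψ par@((φ≢ψ , _) , _ , mis≡) τ =
    to , ParentSon-cycle⊆perms (Parent⇒ParentSon sφ sψ par)
    where
    to : InPerms n φ τ × InPerms n ψ τ → InCycle (tilde n ψ) τ
    to (τ∈φ , τ∈ψ) with common-perm-ParentSon sφ sψ φ≢ψ τ∈φ τ∈ψ
    ... | inj₁ (_ , τ∈cycle) = τ∈cycle
    ... | inj₂ (ψφ , _) = ⊥-elim (ParentSon⇒mis≢ ψφ mis≡)

  sons-exist : (φ : List ℕ) → IsSeed n φ → 1 < height n φ → (i : ℕ) → 1 ≤ i → i ≤ n ∸ 3 →
    ∃ λ β → IsSeed n β × Son n φ i β
  sons-exist _ (a , [] , refl , p) (s≤s ()) _ _ _
  sons-exist _ (a , b ∷ r , refl , p) 1<height (suc i) _ i<N∸2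
    with chain-positive⇒⁺ a b r (s≤s⁻¹ 1<height)
  ... | refl with split-suffix r i
                    (s≤s⁻¹ (subst (λ m → suc i ≤ m ∸ 2) (sym (suc-injective (IsPerm-length p))) i<N∸2))
  ... | xs , ys , refl , refl =
    sonSeed b xs ys , sonSeed-IsSeed b xs ys p , parentSeed-sonSeed-son b xs ys

lemma2 : (n : ℕ) → 4 ≤ n →
  ((φ ψ : List ℕ) → IsSeed n φ → IsSeed n ψ → φ ≢ ψ →
    (Neighbors n φ ψ → Parent n φ ψ ⊎ Parent n ψ φ)
    × (Parent n φ ψ ⊎ Parent n ψ φ → Neighbors n φ ψ))
  × ((φ ψ : List ℕ) → IsSeed n φ → IsSeed n ψ → Parent n φ ψ →
    ((τ : List ℕ) → (InPerms n φ τ × InPerms n ψ τ → InCycle (tilde n ψ) τ)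
                  × (InCycle (tilde n ψ) τ → InPerms n φ τ × InPerms n ψ τ))
    × (∃ λ i → (1 ≤ i) × (i < n)
         × InCycle (tilde n ψ) (sup n φ i)
         × Son n φ i ψ
         × (height n φ < n ∸ 3 → height n ψ ≡ Δ n (height n φ) i)))
  × ((φ : List ℕ) → IsSeed n φ → 1 < height n φ →
    (i : ℕ) → 1 ≤ i → i ≤ n ∸ 3 →
    ∃ λ β → IsSeed n β × Son n φ i β)
lemma2 (suc N) (s≤s 3≤N) =
  neighbors⇔parent ,
  (λ φ ψ sφ sψ par → Parent-common-perms φ ψ sφ sψ par , ParentSon-son sφ (Parent⇒ParentSon sφ sψ par)) ,
  sons-exist
  where open Seeds N 3≤N
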